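{- Let $A=(a_1,a_2,a_3,a_4)\in\mathbb{Z}^4$ and $B=(b_1,b_2,b_3,b_4)\in\mathbb{Z}^4$ be such that the triangle $OAB$ (with $O$ the origin) is equilateral with side length $\sqrt{2L}$, where $L>0$. Then there exist an odd positive integer $k$ dividing $L$ and integers $\alpha_1,\alpha_2,\alpha_3,\beta_1,\beta_2,\beta_3$ with $$\alpha_1^2+\alpha_2^2+\alpha_3^2=\beta_1^2+\beta_2^2+\beta_3^2=3k^2,$$ such that, setting $$v=(0,\ \alpha_1-\beta_1,\ \alpha_2-\beta_2,\ \alpha_3-\beta_3),\qquad w=(\alpha_3-\beta_3,\ -\alpha_2-\beta_2,\ \alpha_1+\beta_1,\ 0),$$ both $\overrightarrow{OA}$ and $\overrightarrow{OB}$ are orthogonal to $v$ and to $w$ (i.e. lie in $\{v,w\}^{\perp}$). Moreover, after applying a suitable permutation of the coordinates and/or changes of sign of coordinates (the same to $A$ and to $B$), the vectors $v$ and $w$ obtained in this way for the transformed triangle can be taken linearly independent.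
   Context: For a set $V\subset\mathbb{R}^4$, $V^{\perp}$ denotes the set of $x\in\mathbb{R}^4$ with $\langle x,u\rangle=0$ for all $u\in V$. An equilateral triangle $OAB$ means $|OA|=|OB|=|AB|>0$. -}

module Defs where

open import Data.Nat as ℕ using (ℕ)
open import Data.Nat.Divisibility using (_∣_)
open import Data.Integer using (ℤ; +_; -_; _+_; _-_; _*_)
open import Data.Fin using (Fin; zero; suc)
open import Data.Fin.Permutation using (Permutation′; _⟨$⟩ʳ_)
open import Data.Sign using (Sign)
open import Data.Product using (_×_; Σ; ∃-syntax; _,_)
open import Relation.Binary.PropositionalEquality using (_≡_)
open import Relation.Nullary using (¬_)

ℤ⁴ : Set
ℤ⁴ = Fin 4 → ℤ

c₀ c₁ c₂ c₃ : Fin 4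
c₀ = zero
c₁ = suc zero
c₂ = suc (suc zero)
c₃ = suc (suc (suc zero))

⟪_,_⟫ : ℤ⁴ → ℤ⁴ → ℤ
⟪ x , y ⟫ = x c₀ * y c₀ + x c₁ * y c₁ + x c₂ * y c₂ + x c₃ * y c₃

∥_∥² : ℤ⁴ → ℤ
∥ x ∥² = ⟪ x , x ⟫

_⊖_ : ℤ⁴ → ℤ⁴ → ℤ⁴
(x ⊖ y) i = x i - y i

EquilateralSide : ℤ⁴ → ℤ⁴ → ℕ → Set
EquilateralSide A B L =
  (∥ A ∥² ≡ + (2 ℕ.* L)) × (∥ B ∥² ≡ + (2 ℕ.* L)) × (∥ A ⊖ B ∥² ≡ + (2 ℕ.* L))

ℤ³ : Set
ℤ³ = Fin 3 → ℤ

d₀ d₁ d₂ : Fin 3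
d₀ = zero
d₁ = suc zero
d₂ = suc (suc zero)

sq³ : ℤ³ → ℤ
sq³ a = a d₀ * a d₀ + a d₁ * a d₁ + a d₂ * a d₂

vec-v : ℤ³ → ℤ³ → ℤ⁴
vec-v α β zero = + 0
vec-v α β (suc zero) = α d₀ - β d₀
vec-v α β (suc (suc zero)) = α d₁ - β d₁
vec-v α β (suc (suc (suc zero))) = α d₂ - β d₂

vec-w : ℤ³ → ℤ³ → ℤ⁴
vec-w α β zero = α d₂ - β d₂
vec-w α β (suc zero) = - α d₁ - β d₁
vec-w α β (suc (suc zero)) = α d₀ + β d₀
vec-w α β (suc (suc (suc zero))) = + 0

Perp₂ : ℤ⁴ → ℤ⁴ → ℤ⁴ → Set
Perp₂ v w x = (⟪ x , v ⟫ ≡ + 0) × (⟪ x , w ⟫ ≡ + 0)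

-- linear independence of two vectors (integer coefficients; equivalent to over ℚ/ℝ by clearing denominators)
LinIndep₂ : ℤ⁴ → ℤ⁴ → Set
LinIndep₂ v w = ∀ (a b : ℤ) → (∀ i → a * v i + b * w i ≡ + 0) → (a ≡ + 0) × (b ≡ + 0)

Witness : ℤ⁴ → ℤ⁴ → ℕ → ℕ → ℤ³ → ℤ³ → Set
Witness A B L k α β =
  (0 ℕ.< k) × (¬ (2 ∣ k)) × (k ∣ L)
  × (sq³ α ≡ + (3 ℕ.* (k ℕ.* k))) × (sq³ β ≡ + (3 ℕ.* (k ℕ.* k)))
  × Perp₂ (vec-v α β) (vec-w α β) A × Perp₂ (vec-v α β) (vec-w α β) B

signℤ : Sign → ℤ
signℤ Sign.+ = + 1
signℤ Sign.- = - (+ 1)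

signedPerm : Permutation′ 4 → (Fin 4 → Sign) → ℤ⁴ → ℤ⁴
signedPerm π ε x i = signℤ (ε i) * x (π ⟨$⟩ʳ i)

module Submission where

-- Let p_ij = x_i y_j − x_j y_i be the Plücker coordinates of the plane spanned by X, Y ∈ ℤ⁴.
-- Their self-dual and anti-self-dual combinations
--   α = (p01 + p23, p02 − p13, p03 + p12),   β = (p01 − p23, p02 + p13, p03 − p12)
-- satisfy |α|² = |β|² = Σ p_ij² = |X|²|Y|² − ⟨X,Y⟩² (Lagrange's identity together with
-- the Plücker relation), and X, Y are orthogonal to the vectors v, w built from α, β.
-- For an equilateral triangle OAB of side √(2L) one has ⟨A,B⟩ = L, hence |α|² = |β|² = 3L²,
-- so the proposition holds with k = L, except that k has to be odd.  If k is even, a sum of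
-- three squares equal to 3k² is divisible by 4, which forces all three terms to be even, and
-- (α/2, β/2) works for k/2; strong induction reaches the odd part of L.
-- Finally v and w are independent once v₃ = α₃ − β₃ = 2 p12 ≠ 0, a property kept by halving.
-- As Σ p_ij² = 3L² > 0 some p_ij ≠ 0, and a permutation of coordinates, which preserves all
-- inner products, moves it to position (1,2).

open import Defs
open import Data.Nat using (ℕ; _<_)
open import Data.Fin using (Fin)
open import Data.Fin.Permutation using (Permutation′)
open import Data.Sign using (Sign)
open import Data.Product using (_×_; ∃-syntax)

import Data.Nat as ℕ
open import Data.Nat using (zero; suc; z≤n; s≤s)
import Data.Nat.Properties as ℕP
open import Data.Nat.Divisibility using (_∣_; divides; _∣?_; ∣-refl; ∣-trans; m∣m*n)
open import Data.Nat.Induction using (<-wellFounded)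
open import Induction.WellFounded using (Acc; acc)
open import Data.Fin using (zero; suc)
open import Data.Fin.Permutation using (_⟨$⟩ʳ_; id; transpose; _∘ₚ_)
open import Data.Integer using (ℤ; +_; _+_; _*_; _-_; -_; 0ℤ; _≟_)
import Data.Integer.Properties as ℤP
import Data.Integer.DivMod as ℤDivMod
import Data.Integer.Divisibility.Signed as ℤDiv
open import Data.Integer.Tactic.RingSolver using (solve-∀)
import Data.Nat.Tactic.RingSolver as ℕSolver
open import Algebra.Properties.CommutativeMonoid.Sum ℤP.+-0-commutativeMonoid
  using (sum; sum-permute; sum-cong-≗)
open import Data.Product using (_,_; proj₁; proj₂)
open import Data.Sum using (inj₁; inj₂)
open import Data.Empty using (⊥-elim)
open import Relation.Nullary using (¬_; yes; no)
open import Relation.Nullary.Decidable using (from-no)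
open import Relation.Binary.PropositionalEquality
  using (_≡_; refl; sym; trans; cong; cong₂; subst; module ≡-Reasoning)

plücker : ℤ⁴ → ℤ⁴ → Fin 4 → Fin 4 → ℤ
plücker X Y i j = X i * Y j - X j * Y i

triple : ℤ → ℤ → ℤ → ℤ³
triple a b c zero = a
triple a b c (suc zero) = b
triple a b c (suc (suc zero)) = c

selfDual antiSelfDual : ℤ⁴ → ℤ⁴ → ℤ³
selfDual X Y = triple (p c₀ c₁ + p c₂ c₃) (p c₀ c₂ - p c₁ c₃) (p c₀ c₃ + p c₁ c₂)
  where p = plücker X Y
antiSelfDual X Y = triple (p c₀ c₁ - p c₂ c₃) (p c₀ c₂ + p c₁ c₃) (p c₀ c₃ - p c₁ c₂)
  where p = plücker X Y

plückerNorm : ℤ⁴ → ℤ⁴ → ℤ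
plückerNorm X Y = p c₀ c₁ * p c₀ c₁ + p c₀ c₂ * p c₀ c₂ + p c₀ c₃ * p c₀ c₃
  + p c₁ c₂ * p c₁ c₂ + p c₁ c₃ * p c₁ c₃ + p c₂ c₃ * p c₂ c₃
  where p = plücker X Y

gramDet : ℤ⁴ → ℤ⁴ → ℤ
gramDet X Y = ∥ X ∥² * ∥ Y ∥² - ⟪ X , Y ⟫ * ⟪ X , Y ⟫

lagrange : ∀ X Y → plückerNorm X Y ≡ gramDet X Y
lagrange X Y = identity (X c₀) (X c₁) (X c₂) (X c₃) (Y c₀) (Y c₁) (Y c₂) (Y c₃)
  where
  identity : ∀ x0 x1 x2 x3 y0 y1 y2 y3 →
    let p01 = x0 * y1 - x1 * y0 ; p02 = x0 * y2 - x2 * y0 ; p03 = x0 * y3 - x3 * y0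
        p12 = x1 * y2 - x2 * y1 ; p13 = x1 * y3 - x3 * y1 ; p23 = x2 * y3 - x3 * y2
        xx = x0 * x0 + x1 * x1 + x2 * x2 + x3 * x3
        yy = y0 * y0 + y1 * y1 + y2 * y2 + y3 * y3
        xy = x0 * y0 + x1 * y1 + x2 * y2 + x3 * y3
    in p01 * p01 + p02 * p02 + p03 * p03 + p12 * p12 + p13 * p13 + p23 * p23 ≡ xx * yy - xy * xy
  identity = solve-∀

plücker-relation : ∀ X Y →
  plücker X Y c₀ c₁ * plücker X Y c₂ c₃ - plücker X Y c₀ c₂ * plücker X Y c₁ c₃
    + plücker X Y c₀ c₃ * plücker X Y c₁ c₂ ≡ 0ℤ
plücker-relation X Y = identity (X c₀) (X c₁) (X c₂) (X c₃) (Y c₀) (Y c₁) (Y c₂) (Y c₃)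
  where
  identity : ∀ x0 x1 x2 x3 y0 y1 y2 y3 →
    let p01 = x0 * y1 - x1 * y0 ; p02 = x0 * y2 - x2 * y0 ; p03 = x0 * y3 - x3 * y0
        p12 = x1 * y2 - x2 * y1 ; p13 = x1 * y3 - x3 * y1 ; p23 = x2 * y3 - x3 * y2
    in p01 * p23 - p02 * p13 + p03 * p12 ≡ 0ℤ
  identity = solve-∀

-- |α|² = |β|² = |X|²|Y|² − ⟨X,Y⟩²: both expand to Σ p_ij² ± 2·(Plücker relation).
selfDual-norm : ∀ X Y → sq³ (selfDual X Y) ≡ gramDet X Y
selfDual-norm X Y = begin
  sq³ (selfDual X Y)                         ≡⟨ expand (p c₀ c₁) (p c₀ c₂) (p c₀ c₃) (p c₁ c₂) (p c₁ c₃) (p c₂ c₃) ⟩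
  plückerNorm X Y + + 2 * relation           ≡⟨ cong (λ r → plückerNorm X Y + + 2 * r) (plücker-relation X Y) ⟩
  plückerNorm X Y + 0ℤ                       ≡⟨ ℤP.+-identityʳ _ ⟩
  plückerNorm X Y                            ≡⟨ lagrange X Y ⟩
  gramDet X Y                                ∎
  where
  open ≡-Reasoning
  p = plücker X Y
  relation = p c₀ c₁ * p c₂ c₃ - p c₀ c₂ * p c₁ c₃ + p c₀ c₃ * p c₁ c₂
  expand : ∀ p01 p02 p03 p12 p13 p23 →
    (p01 + p23) * (p01 + p23) + (p02 - p13) * (p02 - p13) + (p03 + p12) * (p03 + p12)
      ≡ p01 * p01 + p02 * p02 + p03 * p03 + p12 * p12 + p13 * p13 + p23 * p23
        + + 2 * (p01 * p23 - p02 * p13 + p03 * p12)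
  expand = solve-∀
antiSelfDual-norm : ∀ X Y → sq³ (antiSelfDual X Y) ≡ gramDet X Y
antiSelfDual-norm X Y = begin
  sq³ (antiSelfDual X Y)                     ≡⟨ expand (p c₀ c₁) (p c₀ c₂) (p c₀ c₃) (p c₁ c₂) (p c₁ c₃) (p c₂ c₃) ⟩
  plückerNorm X Y - + 2 * relation           ≡⟨ cong (λ r → plückerNorm X Y - + 2 * r) (plücker-relation X Y) ⟩
  plückerNorm X Y - 0ℤ                       ≡⟨ ℤP.+-identityʳ _ ⟩
  plückerNorm X Y                            ≡⟨ lagrange X Y ⟩
  gramDet X Y                                ∎
  where
  open ≡-Reasoning
  p = plücker X Y
  relation = p c₀ c₁ * p c₂ c₃ - p c₀ c₂ * p c₁ c₃ + p c₀ c₃ * p c₁ c₂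
  expand : ∀ p01 p02 p03 p12 p13 p23 →
    (p01 - p23) * (p01 - p23) + (p02 + p13) * (p02 + p13) + (p03 - p12) * (p03 - p12)
      ≡ p01 * p01 + p02 * p02 + p03 * p03 + p12 * p12 + p13 * p13 + p23 * p23
        - + 2 * (p01 * p23 - p02 * p13 + p03 * p12)
  expand = solve-∀

-- X and Y are orthogonal to v and w built from (α, β): the entries of v/2 and w/2 are
-- Plücker coordinates, and each orthogonality is a determinant with a repeated row.
plane-⊥ : ∀ X Y →
  let α = selfDual X Y ; β = antiSelfDual X Y
  in Perp₂ (vec-v α β) (vec-w α β) X × Perp₂ (vec-v α β) (vec-w α β) Y
plane-⊥ X Y = (⊥v-left x0 x1 x2 x3 y0 y1 y2 y3 , ⊥w-left x0 x1 x2 x3 y0 y1 y2 y3)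
            , (⊥v-right x0 x1 x2 x3 y0 y1 y2 y3 , ⊥w-right x0 x1 x2 x3 y0 y1 y2 y3)
  where
  x0 = X c₀ ; x1 = X c₁ ; x2 = X c₂ ; x3 = X c₃
  y0 = Y c₀ ; y1 = Y c₁ ; y2 = Y c₂ ; y3 = Y c₃
  ⊥v-left : ∀ x0 x1 x2 x3 y0 y1 y2 y3 →
    let p01 = x0 * y1 - x1 * y0 ; p02 = x0 * y2 - x2 * y0 ; p03 = x0 * y3 - x3 * y0
        p12 = x1 * y2 - x2 * y1 ; p13 = x1 * y3 - x3 * y1 ; p23 = x2 * y3 - x3 * y2
    in x0 * + 0 + x1 * ((p01 + p23) - (p01 - p23)) + x2 * ((p02 - p13) - (p02 + p13))
         + x3 * ((p03 + p12) - (p03 - p12)) ≡ 0ℤ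
  ⊥v-left = solve-∀
  ⊥v-right : ∀ x0 x1 x2 x3 y0 y1 y2 y3 →
    let p01 = x0 * y1 - x1 * y0 ; p02 = x0 * y2 - x2 * y0 ; p03 = x0 * y3 - x3 * y0
        p12 = x1 * y2 - x2 * y1 ; p13 = x1 * y3 - x3 * y1 ; p23 = x2 * y3 - x3 * y2
    in y0 * + 0 + y1 * ((p01 + p23) - (p01 - p23)) + y2 * ((p02 - p13) - (p02 + p13))
         + y3 * ((p03 + p12) - (p03 - p12)) ≡ 0ℤ
  ⊥v-right = solve-∀
  ⊥w-left : ∀ x0 x1 x2 x3 y0 y1 y2 y3 →
    let p01 = x0 * y1 - x1 * y0 ; p02 = x0 * y2 - x2 * y0 ; p03 = x0 * y3 - x3 * y0
        p12 = x1 * y2 - x2 * y1 ; p13 = x1 * y3 - x3 * y1 ; p23 = x2 * y3 - x3 * y2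
    in x0 * ((p03 + p12) - (p03 - p12)) + x1 * (- (p02 - p13) - (p02 + p13))
         + x2 * ((p01 + p23) + (p01 - p23)) + x3 * + 0 ≡ 0ℤ
  ⊥w-left = solve-∀
  ⊥w-right : ∀ x0 x1 x2 x3 y0 y1 y2 y3 →
    let p01 = x0 * y1 - x1 * y0 ; p02 = x0 * y2 - x2 * y0 ; p03 = x0 * y3 - x3 * y0
        p12 = x1 * y2 - x2 * y1 ; p13 = x1 * y3 - x3 * y1 ; p23 = x2 * y3 - x3 * y2
    in y0 * ((p03 + p12) - (p03 - p12)) + y1 * (- (p02 - p13) - (p02 + p13))
         + y2 * ((p01 + p23) + (p01 - p23)) + y3 * + 0 ≡ 0ℤ
  ⊥w-right = solve-∀

Represents : ℤ⁴ → ℤ⁴ → ℕ → ℤ³ → ℤ³ → Set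
Represents X Y k α β = (sq³ α ≡ + (3 ℕ.* (k ℕ.* k))) × (sq³ β ≡ + (3 ℕ.* (k ℕ.* k)))
  × Perp₂ (vec-v α β) (vec-w α β) X × Perp₂ (vec-v α β) (vec-w α β) Y

Twice : ∀ {n} → (Fin n → ℤ) → (Fin n → ℤ) → Set
Twice u u' = ∀ i → u i ≡ + 2 * u' i

-- The coordinate v₃ = α₃ − β₃ is nonzero; this is what makes v, w independent.
LastNonzero : ℤ³ → ℤ³ → Set
LastNonzero α β = ¬ (vec-v α β c₃ ≡ 0ℤ)

twice-diff : ∀ {a b} a' b' → a ≡ + 2 * a' → b ≡ + 2 * b' → a - b ≡ + 2 * (a' - b')
twice-diff a' b' refl refl = identity a' b'
  where
  identity : ∀ a' b' → + 2 * a' - + 2 * b' ≡ + 2 * (a' - b')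
  identity = solve-∀

twice-sum : ∀ {a b} a' b' → a ≡ + 2 * a' → b ≡ + 2 * b' → a + b ≡ + 2 * (a' + b')
twice-sum a' b' refl refl = sym (ℤP.*-distribˡ-+ (+ 2) a' b')

twice-neg-diff : ∀ {a b} a' b' → a ≡ + 2 * a' → b ≡ + 2 * b' → - a - b ≡ + 2 * (- a' - b')
twice-neg-diff a' b' refl refl = identity a' b'
  where
  identity : ∀ a' b' → - (+ 2 * a') - + 2 * b' ≡ + 2 * (- a' - b')
  identity = solve-∀

vec-v-twice : ∀ {α α' β β'} → Twice α α' → Twice β β' → Twice (vec-v α β) (vec-v α' β')
vec-v-twice tα tβ zero = refl
vec-v-twice {α' = α'} {β' = β'} tα tβ (suc zero) = twice-diff (α' d₀) (β' d₀) (tα d₀) (tβ d₀)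
vec-v-twice {α' = α'} {β' = β'} tα tβ (suc (suc zero)) = twice-diff (α' d₁) (β' d₁) (tα d₁) (tβ d₁)
vec-v-twice {α' = α'} {β' = β'} tα tβ (suc (suc (suc zero))) =
  twice-diff (α' d₂) (β' d₂) (tα d₂) (tβ d₂)

vec-w-twice : ∀ {α α' β β'} → Twice α α' → Twice β β' → Twice (vec-w α β) (vec-w α' β')
vec-w-twice {α' = α'} {β' = β'} tα tβ zero = twice-diff (α' d₂) (β' d₂) (tα d₂) (tβ d₂)
vec-w-twice {α' = α'} {β' = β'} tα tβ (suc zero) = twice-neg-diff (α' d₁) (β' d₁) (tα d₁) (tβ d₁)
vec-w-twice {α' = α'} {β' = β'} tα tβ (suc (suc zero)) = twice-sum (α' d₀) (β' d₀) (tα d₀) (tβ d₀)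
vec-w-twice tα tβ (suc (suc (suc zero))) = refl

⟪⟫-twice : ∀ X {u u'} → Twice u u' → ⟪ X , u ⟫ ≡ + 2 * ⟪ X , u' ⟫
⟪⟫-twice X {u' = u'} t = trans (cong₂ _+_ (cong₂ _+_ (cong₂ _+_ (term c₀) (term c₁)) (term c₂)) (term c₃))
  (identity (X c₀) (X c₁) (X c₂) (X c₃) (u' c₀) (u' c₁) (u' c₂) (u' c₃))
  where
  term : ∀ i → X i * _ ≡ X i * (+ 2 * u' i)
  term i = cong (X i *_) (t i)
  identity : ∀ x0 x1 x2 x3 u0 u1 u2 u3 →
    x0 * (+ 2 * u0) + x1 * (+ 2 * u1) + x2 * (+ 2 * u2) + x3 * (+ 2 * u3)
      ≡ + 2 * (x0 * u0 + x1 * u1 + x2 * u2 + x3 * u3)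
  identity = solve-∀

sq³-twice : ∀ {α α'} → Twice α α' → sq³ α ≡ + 4 * sq³ α'
sq³-twice {α' = α'} t = trans (cong₂ _+_ (cong₂ _+_ (square d₀) (square d₁)) (square d₂))
  (identity (α' d₀) (α' d₁) (α' d₂))
  where
  square : ∀ i → _ ≡ (+ 2 * α' i) * (+ 2 * α' i)
  square i = cong₂ _*_ (t i) (t i)
  identity : ∀ a0 a1 a2 →
    (+ 2 * a0) * (+ 2 * a0) + (+ 2 * a1) * (+ 2 * a1) + (+ 2 * a2) * (+ 2 * a2)
      ≡ + 4 * (a0 * a0 + a1 * a1 + a2 * a2)
  identity = solve-∀

parity : ∀ x → ∃[ q ] ∃[ r ] (r ℕ.≤ 1) × (x ≡ + r + q * + 2)
parity x = x ℤDivMod./ℕ 2 , x ℤDivMod.%ℕ 2 , ℕP.≤-pred (ℤDivMod.n%ℕd<d x 2) , ℤDivMod.a≡a%ℕn+[a/ℕn]*n x 2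

mod4-residue : ∀ c S T → + c + + 4 * S ≡ + 4 * T → 4 ∣ c
mod4-residue c S T e = ℤDiv.∣⇒∣ᵤ (ℤDiv.∣m+n∣n⇒∣m {m = + c} 4∣sum (ℤDiv.∣m⇒∣m*n S ℤDiv.∣-refl))
  where
  4∣sum : + 4 ℤDiv.∣ (+ c + + 4 * S)
  4∣sum = subst (+ 4 ℤDiv.∣_) (sym e) (ℤDiv.∣m⇒∣m*n T ℤDiv.∣-refl)

-- For residues r_i ∈ {0, 1}, r0² + r1² + r2² = r0 + r1 + r2 ≤ 3 is divisible by 4 only if
-- all r_i vanish.
residues-vanish : ∀ {r0 r1 r2} S T → r0 ℕ.≤ 1 → r1 ℕ.≤ 1 → r2 ℕ.≤ 1 →
  (+ r0 * + r0 + + r1 * + r1 + + r2 * + r2) + + 4 * S ≡ + 4 * T → (r0 ≡ 0) × (r1 ≡ 0) × (r2 ≡ 0)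
residues-vanish S T z≤n z≤n z≤n e = refl , refl , refl
residues-vanish S T z≤n z≤n (s≤s z≤n) e = ⊥-elim (from-no (4 ∣? 1) (mod4-residue 1 S T e))
residues-vanish S T z≤n (s≤s z≤n) z≤n e = ⊥-elim (from-no (4 ∣? 1) (mod4-residue 1 S T e))
residues-vanish S T z≤n (s≤s z≤n) (s≤s z≤n) e = ⊥-elim (from-no (4 ∣? 2) (mod4-residue 2 S T e))
residues-vanish S T (s≤s z≤n) z≤n z≤n e = ⊥-elim (from-no (4 ∣? 1) (mod4-residue 1 S T e))
residues-vanish S T (s≤s z≤n) z≤n (s≤s z≤n) e = ⊥-elim (from-no (4 ∣? 2) (mod4-residue 2 S T e))
residues-vanish S T (s≤s z≤n) (s≤s z≤n) z≤n e = ⊥-elim (from-no (4 ∣? 2) (mod4-residue 2 S T e))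
residues-vanish S T (s≤s z≤n) (s≤s z≤n) (s≤s z≤n) e = ⊥-elim (from-no (4 ∣? 3) (mod4-residue 3 S T e))

three-squares-even : ∀ α T → sq³ α ≡ + 4 * T → ∃[ α' ] Twice α α'
three-squares-even α T e with parity (α d₀) | parity (α d₁) | parity (α d₂)
... | q0 , r0 , r0≤1 , e0 | q1 , r1 , r1≤1 , e1 | q2 , r2 , r2≤1 , e2 = triple q0 q1 q2 , halves
  where
  S = q0 * q0 + q0 * + r0 + q1 * q1 + q1 * + r1 + q2 * q2 + q2 * + r2
  square : ∀ {x y : ℤ} → x ≡ y → x * x ≡ y * y
  square ex = cong₂ _*_ ex ex
  expand : ∀ r0 r1 r2 q0 q1 q2 →
    (r0 + q0 * + 2) * (r0 + q0 * + 2) + (r1 + q1 * + 2) * (r1 + q1 * + 2) + (r2 + q2 * + 2) * (r2 + q2 * + 2)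
      ≡ (r0 * r0 + r1 * r1 + r2 * r2) + + 4 * (q0 * q0 + q0 * r0 + q1 * q1 + q1 * r1 + q2 * q2 + q2 * r2)
  expand = solve-∀
  residues : (r0 ≡ 0) × (r1 ≡ 0) × (r2 ≡ 0)
  residues = residues-vanish S T r0≤1 r1≤1 r2≤1
    (trans (sym (trans (cong₂ _+_ (cong₂ _+_ (square e0) (square e1)) (square e2))
                       (expand (+ r0) (+ r1) (+ r2) q0 q1 q2))) e)
  even : ∀ {x q r} → x ≡ + r + q * + 2 → r ≡ 0 → x ≡ + 2 * q
  even {q = q} ex refl = trans ex (trans (ℤP.+-identityˡ (q * + 2)) (ℤP.*-comm q (+ 2)))
  halves : Twice α (triple q0 q1 q2)
  halves zero = even e0 (proj₁ residues)
  halves (suc zero) = even e1 (proj₁ (proj₂ residues))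
  halves (suc (suc zero)) = even e2 (proj₂ (proj₂ residues))

three-squares-of-double : ∀ m → + (3 ℕ.* ((m ℕ.* 2) ℕ.* (m ℕ.* 2))) ≡ + 4 * + (3 ℕ.* (m ℕ.* m))
three-squares-of-double m = trans (cong +_ (identity m)) (ℤP.pos-* 4 (3 ℕ.* (m ℕ.* m)))
  where
  identity : ∀ m → 3 ℕ.* ((m ℕ.* 2) ℕ.* (m ℕ.* 2)) ≡ 4 ℕ.* (3 ℕ.* (m ℕ.* m))
  identity = ℕSolver.solve-∀

halve : ∀ X Y m α β → Represents X Y (m ℕ.* 2) α β →
  ∃[ α' ] ∃[ β' ] Twice α α' × Twice β β' × Represents X Y m α' β'
halve X Y m α β (|α|² , |β|² , (Xv , Xw) , (Yv , Yw))
  with three-squares-even α (+ (3 ℕ.* (m ℕ.* m))) (trans |α|² (three-squares-of-double m))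
     | three-squares-even β (+ (3 ℕ.* (m ℕ.* m))) (trans |β|² (three-squares-of-double m))
... | α' , tα | β' , tβ =
  α' , β' , tα , tβ , quarter tα |α|² , quarter tβ |β|²
  , (half X (vec-v-twice tα tβ) Xv , half X (vec-w-twice tα tβ) Xw)
  , (half Y (vec-v-twice tα tβ) Yv , half Y (vec-w-twice tα tβ) Yw)
  where
  quarter : ∀ {γ γ'} → Twice γ γ' → sq³ γ ≡ + (3 ℕ.* ((m ℕ.* 2) ℕ.* (m ℕ.* 2))) →
    sq³ γ' ≡ + (3 ℕ.* (m ℕ.* m))
  quarter t e = ℤP.*-cancelˡ-≡ (+ 4) _ _ (trans (sym (sq³-twice t)) (trans e (three-squares-of-double m)))
  half : ∀ Z {u u'} → Twice u u' → ⟪ Z , u ⟫ ≡ 0ℤ → ⟪ Z , u' ⟫ ≡ 0ℤ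
  half Z t e = ℤP.*-cancelˡ-≡ (+ 2) _ _ (trans (sym (⟪⟫-twice Z t)) e)

lastNonzero-half : ∀ {α α' β β'} → Twice α α' → Twice β β' → LastNonzero α β → LastNonzero α' β'
lastNonzero-half tα tβ nz z = nz (trans (vec-v-twice tα tβ c₃) (cong (+ 2 *_) z))

OddRepresentation : ℤ⁴ → ℤ⁴ → ℕ → ℤ³ → ℤ³ → Set
OddRepresentation X Y k α β = ∃[ k' ] ∃[ α' ] ∃[ β' ]
  (0 < k') × (¬ (2 ∣ k')) × (k' ∣ k) × Represents X Y k' α' β' × (LastNonzero α β → LastNonzero α' β')

odd-descent : ∀ X Y k α β → 0 < k → Represents X Y k α β → OddRepresentation X Y k α β
odd-descent X Y k = descend k (<-wellFounded k)
  where
  descend : ∀ k → Acc _<_ k → ∀ α β → 0 < k → Represents X Y k α β → OddRepresentation X Y k α β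
  descend k _ α β 0<k rep with 2 ∣? k
  ... | no k-odd = k , α , β , 0<k , k-odd , ∣-refl , rep , λ nz → nz
  ... | yes (divides zero k≡0) = ⊥-elim (ℕP.<⇒≢ 0<k (sym k≡0))
  descend k (acc smaller) α β 0<k rep | yes (divides (suc m) k≡2m) =
    recurse (halve X Y (suc m) α β (subst (λ j → Represents X Y j α β) k≡2m rep))
    where
    m<k : suc m < k
    m<k = subst (suc m <_) (sym k≡2m) (ℕP.m<m*n (suc m) 2 (s≤s (s≤s z≤n)))
    recurse : (∃[ α' ] ∃[ β' ] Twice α α' × Twice β β' × Represents X Y (suc m) α' β') →
      OddRepresentation X Y k α β
    recurse (α' , β' , tα , tβ , rep') with descend (suc m) (smaller m<k) α' β' (s≤s z≤n) rep'
    ... | k' , α'' , β'' , 0<k' , k'-odd , k'∣m , rep'' , keep =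
      k' , α'' , β'' , 0<k' , k'-odd , subst (k' ∣_) (sym k≡2m) (∣-trans k'∣m (m∣m*n 2)) , rep''
      , λ nz → keep (lastNonzero-half tα tβ nz)

EquilateralGram : ℤ⁴ → ℤ⁴ → ℕ → Set
EquilateralGram X Y L = (∥ X ∥² ≡ + (2 ℕ.* L)) × (∥ Y ∥² ≡ + (2 ℕ.* L)) × (⟪ X , Y ⟫ ≡ + L)

polarization : ∀ A B → ∥ A ⊖ B ∥² ≡ ∥ A ∥² + ∥ B ∥² - + 2 * ⟪ A , B ⟫
polarization A B = identity (A c₀) (A c₁) (A c₂) (A c₃) (B c₀) (B c₁) (B c₂) (B c₃)
  where
  identity : ∀ a0 a1 a2 a3 b0 b1 b2 b3 →
    (a0 - b0) * (a0 - b0) + (a1 - b1) * (a1 - b1) + (a2 - b2) * (a2 - b2) + (a3 - b3) * (a3 - b3)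
      ≡ (a0 * a0 + a1 * a1 + a2 * a2 + a3 * a3) + (b0 * b0 + b1 * b1 + b2 * b2 + b3 * b3)
        - + 2 * (a0 * b0 + a1 * b1 + a2 * b2 + a3 * b3)
  identity = solve-∀

equilateral-gram : ∀ A B L → EquilateralSide A B L → EquilateralGram A B L
equilateral-gram A B L (|A|² , |B|² , |A-B|²) = |A|² , |B|² , ℤP.*-cancelˡ-≡ (+ 2) _ _ twice-inner
  where
  open ≡-Reasoning
  s = + (2 ℕ.* L)
  solve-linear : ∀ s t → t ≡ s + s - (s + s - t)
  solve-linear = solve-∀
  cancel : ∀ s → s + s - s ≡ s
  cancel = solve-∀
  twice-inner : + 2 * ⟪ A , B ⟫ ≡ + 2 * + L
  twice-inner = begin
    + 2 * ⟪ A , B ⟫                              ≡⟨ solve-linear s _ ⟩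
    s + s - (s + s - + 2 * ⟪ A , B ⟫)            ≡⟨ cong (λ t → s + s - (t - + 2 * ⟪ A , B ⟫)) (cong₂ _+_ |A|² |B|²) ⟨
    s + s - (∥ A ∥² + ∥ B ∥² - + 2 * ⟪ A , B ⟫)  ≡⟨ cong (λ t → s + s - t) (polarization A B) ⟨
    s + s - ∥ A ⊖ B ∥²                           ≡⟨ cong (λ t → s + s - t) |A-B|² ⟩
    s + s - s                                    ≡⟨ cancel s ⟩
    s                                            ≡⟨ ℤP.pos-* 2 L ⟩
    + 2 * + L                                    ∎

gramDet-equilateral : ∀ X Y L → EquilateralGram X Y L → gramDet X Y ≡ + (3 ℕ.* (L ℕ.* L))
gramDet-equilateral X Y L (|X|² , |Y|² , ⟨X,Y⟩) = begin
  gramDet X Y                             ≡⟨ cong₂ _-_ (cong₂ _*_ |X|² |Y|²) (cong₂ _*_ ⟨X,Y⟩ ⟨X,Y⟩) ⟩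
  + (2 ℕ.* L) * + (2 ℕ.* L) - + L * + L   ≡⟨ cong (λ d → d * d - + L * + L) (ℤP.pos-* 2 L) ⟩
  (+ 2 * + L) * (+ 2 * + L) - + L * + L   ≡⟨ identity (+ L) ⟩
  + 3 * (+ L * + L)                       ≡⟨ cong (+ 3 *_) (ℤP.pos-* L L) ⟨
  + 3 * + (L ℕ.* L)                       ≡⟨ ℤP.pos-* 3 (L ℕ.* L) ⟨
  + (3 ℕ.* (L ℕ.* L))                     ∎
  where
  open ≡-Reasoning
  identity : ∀ l → (+ 2 * l) * (+ 2 * l) - l * l ≡ + 3 * (l * l)
  identity = solve-∀

three-squares-positive : ∀ L → 0 < L → ¬ (+ (3 ℕ.* (L ℕ.* L)) ≡ 0ℤ)
three-squares-positive (suc l) _ ()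

plücker-represents : ∀ X Y L → EquilateralGram X Y L →
  Represents X Y L (selfDual X Y) (antiSelfDual X Y)
plücker-represents X Y L G =
  trans (selfDual-norm X Y) det , trans (antiSelfDual-norm X Y) det , plane-⊥ X Y
  where
  det = gramDet-equilateral X Y L G

plücker-last : ∀ X Y → vec-v (selfDual X Y) (antiSelfDual X Y) c₃ ≡ + 2 * plücker X Y c₁ c₂
plücker-last X Y = identity (plücker X Y c₀ c₃) (plücker X Y c₁ c₂)
  where
  identity : ∀ a b → (a + b) - (a - b) ≡ + 2 * b
  identity = solve-∀

-- If v₀ = 0 and w₃ = 0 while v₃, w₀ ≠ 0, then v and w are independent: coordinate 3 of
-- av + bw is a·v₃ and coordinate 0 is b·w₀.
corner-independent : ∀ (v w : ℤ⁴) → v c₀ ≡ 0ℤ → w c₃ ≡ 0ℤ →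
  ¬ (v c₃ ≡ 0ℤ) → ¬ (w c₀ ≡ 0ℤ) → LinIndep₂ v w
corner-independent v w v₀≡0 w₃≡0 v₃≢0 w₀≢0 a b combo = cancel a v₃≢0 at₃ , cancel b w₀≢0 at₀
  where
  cancel : ∀ a {x} → ¬ (x ≡ 0ℤ) → a * x ≡ 0ℤ → a ≡ 0ℤ
  cancel a x≢0 ax≡0 with ℤP.i*j≡0⇒i≡0∨j≡0 a ax≡0
  ... | inj₁ a≡0 = a≡0
  ... | inj₂ x≡0 = ⊥-elim (x≢0 x≡0)
  at₃ : a * v c₃ ≡ 0ℤ
  at₃ = trans (sym (ℤP.+-identityʳ _))
    (trans (cong (λ t → a * v c₃ + t) (sym (trans (cong (b *_) w₃≡0) (ℤP.*-zeroʳ b)))) (combo c₃))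
  at₀ : b * w c₀ ≡ 0ℤ
  at₀ = trans (sym (ℤP.+-identityˡ _))
    (trans (cong (λ t → t + b * w c₀) (sym (trans (cong (a *_) v₀≡0) (ℤP.*-zeroʳ a)))) (combo c₀))

odd-witness : ∀ X Y L → 0 < L → EquilateralGram X Y L →
  ∃[ k ] ∃[ α ] ∃[ β ] Witness X Y L k α β
    × (¬ (plücker X Y c₁ c₂ ≡ 0ℤ) → LinIndep₂ (vec-v α β) (vec-w α β))
odd-witness X Y L 0<L G =
  conclude (odd-descent X Y L (selfDual X Y) (antiSelfDual X Y) 0<L (plücker-represents X Y L G))
  where
  conclude : OddRepresentation X Y L (selfDual X Y) (antiSelfDual X Y) →
    ∃[ k ] ∃[ α ] ∃[ β ] Witness X Y L k α β
      × (¬ (plücker X Y c₁ c₂ ≡ 0ℤ) → LinIndep₂ (vec-v α β) (vec-w α β))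
  conclude (k , α , β , 0<k , k-odd , k∣L , rep , keep) =
    k , α , β , (0<k , k-odd , k∣L , rep) , λ p≢0 → corner-independent (vec-v α β) (vec-w α β) refl refl (v₃≢0 p≢0) (v₃≢0 p≢0)
    where
    v₃≢0 : ¬ (plücker X Y c₁ c₂ ≡ 0ℤ) → LastNonzero α β
    v₃≢0 p≢0 = keep (λ v₃≡0 → p≢0 (ℤP.*-cancelˡ-≡ (+ 2) (plücker X Y c₁ c₂) 0ℤ (trans (sym (plücker-last X Y)) v₃≡0)))

⟪⟫-as-sum : ∀ X Y → ⟪ X , Y ⟫ ≡ sum (λ i → X i * Y i)
⟪⟫-as-sum X Y = identity (X c₀ * Y c₀) (X c₁ * Y c₁) (X c₂ * Y c₂) (X c₃ * Y c₃)
  where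
  identity : ∀ t0 t1 t2 t3 → t0 + t1 + t2 + t3 ≡ t0 + (t1 + (t2 + (t3 + 0ℤ)))
  identity = solve-∀

signℤ-square : ∀ s → signℤ s * signℤ s ≡ + 1
signℤ-square Sign.+ = refl
signℤ-square Sign.- = refl

-- Signed permutations of coordinates preserve the inner product: signs square to 1 and
-- a sum is invariant under permuting its terms.
signedPerm-isometry : ∀ π ε X Y → ⟪ signedPerm π ε X , signedPerm π ε Y ⟫ ≡ ⟪ X , Y ⟫
signedPerm-isometry π ε X Y = begin
  ⟪ signedPerm π ε X , signedPerm π ε Y ⟫              ≡⟨ ⟪⟫-as-sum (signedPerm π ε X) (signedPerm π ε Y) ⟩
  sum (λ i → signedPerm π ε X i * signedPerm π ε Y i)  ≡⟨ sum-cong-≗ unsign ⟩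
  sum (λ i → X (π ⟨$⟩ʳ i) * Y (π ⟨$⟩ʳ i))              ≡⟨ sum-permute (λ j → X j * Y j) π ⟨
  sum (λ j → X j * Y j)                                ≡⟨ ⟪⟫-as-sum X Y ⟨
  ⟪ X , Y ⟫                                            ∎
  where
  open ≡-Reasoning
  regroup : ∀ s x y → (s * x) * (s * y) ≡ (s * s) * (x * y)
  regroup = solve-∀
  unsign : ∀ i → signedPerm π ε X i * signedPerm π ε Y i ≡ X (π ⟨$⟩ʳ i) * Y (π ⟨$⟩ʳ i)
  unsign i = trans (regroup (signℤ (ε i)) _ _)
    (trans (cong (_* (X (π ⟨$⟩ʳ i) * Y (π ⟨$⟩ʳ i))) (signℤ-square (ε i))) (ℤP.*-identityˡ _))

signedPerm-gram : ∀ π ε X Y L → EquilateralGram X Y L →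
  EquilateralGram (signedPerm π ε X) (signedPerm π ε Y) L
signedPerm-gram π ε X Y L (|X|² , |Y|² , ⟨X,Y⟩) =
  trans (isometry X X) |X|² , trans (isometry Y Y) |Y|² , trans (isometry X Y) ⟨X,Y⟩
  where
  isometry = signedPerm-isometry π ε

unsigned : Fin 4 → Sign
unsigned _ = Sign.+

relabel-plücker : ∀ π X Y i j →
  plücker (signedPerm π unsigned X) (signedPerm π unsigned Y) i j ≡ plücker X Y (π ⟨$⟩ʳ i) (π ⟨$⟩ʳ j)
relabel-plücker π X Y i j =
  cong₂ _-_ (cong₂ _*_ (relabel X i) (relabel Y j)) (cong₂ _*_ (relabel X j) (relabel Y i))
  where
  relabel : ∀ Z k → signedPerm π unsigned Z k ≡ Z (π ⟨$⟩ʳ k)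
  relabel Z k = ℤP.*-identityˡ (Z (π ⟨$⟩ʳ k))

-- If the Gram determinant is nonzero then, by Lagrange's identity, some Plücker coordinate
-- is nonzero, and a permutation of the coordinates moves it to position (1,2).
chart : ∀ X Y → ¬ (gramDet X Y ≡ 0ℤ) → ∃[ π ] ¬ (plücker X Y (π ⟨$⟩ʳ c₁) (π ⟨$⟩ʳ c₂) ≡ 0ℤ)
chart X Y det≢0
  with plücker X Y c₀ c₁ ≟ 0ℤ | plücker X Y c₀ c₂ ≟ 0ℤ | plücker X Y c₀ c₃ ≟ 0ℤ
     | plücker X Y c₁ c₂ ≟ 0ℤ | plücker X Y c₁ c₃ ≟ 0ℤ | plücker X Y c₂ c₃ ≟ 0ℤ
... | no p≢0 | _ | _ | _ | _ | _ = transpose c₀ c₁ ∘ₚ transpose c₁ c₂ , p≢0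
... | yes _ | no p≢0 | _ | _ | _ | _ = transpose c₀ c₁ , p≢0
... | yes _ | yes _ | no p≢0 | _ | _ | _ = transpose c₀ c₁ ∘ₚ transpose c₂ c₃ , p≢0
... | yes _ | yes _ | yes _ | no p≢0 | _ | _ = id , p≢0
... | yes _ | yes _ | yes _ | yes _ | no p≢0 | _ = transpose c₂ c₃ , p≢0
... | yes _ | yes _ | yes _ | yes _ | yes _ | no p≢0 = transpose c₁ c₂ ∘ₚ transpose c₁ c₃ , p≢0
... | yes p₀₁ | yes p₀₂ | yes p₀₃ | yes p₁₂ | yes p₁₃ | yes p₂₃ =
  ⊥-elim (det≢0 (trans (sym (lagrange X Y)) (squares-vanish p₀₁ p₀₂ p₀₃ p₁₂ p₁₃ p₂₃)))
  where
  squares-vanish : ∀ {a b c d e f : ℤ} → a ≡ 0ℤ → b ≡ 0ℤ → c ≡ 0ℤ → d ≡ 0ℤ → e ≡ 0ℤ → f ≡ 0ℤ →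
    a * a + b * b + c * c + d * d + e * e + f * f ≡ 0ℤ
  squares-vanish refl refl refl refl refl refl = refl

proposition3p1 : (A B : ℤ⁴) (L : ℕ) → 0 < L → EquilateralSide A B L →
    (∃[ k ] ∃[ α ] ∃[ β ] Witness A B L k α β)
    × (∃[ π ] ∃[ ε ] ∃[ k ] ∃[ α ] ∃[ β ]
        (Witness (signedPerm π ε A) (signedPerm π ε B) L k α β
         × LinIndep₂ (vec-v α β) (vec-w α β)))
proposition3p1 A B L 0<L equilateral =
  let G = equilateral-gram A B L equilateral
      (k , α , β , witness , _) = odd-witness A B L 0<L G
      det≢0 = λ det≡0 → three-squares-positive L 0<L (trans (sym (gramDet-equilateral A B L G)) det≡0)
      (π , p₁₂≢0) = chart A B det≢0
      A′ = signedPerm π unsigned A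
      B′ = signedPerm π unsigned B
      (k′ , α′ , β′ , witness′ , independent) = odd-witness A′ B′ L 0<L (signedPerm-gram π unsigned A B L G)
  in (k , α , β , witness)
     , (π , unsigned , k′ , α′ , β′ , witness′
       , independent (λ p′₁₂≡0 → p₁₂≢0 (trans (sym (relabel-plücker π A B c₁ c₂)) p′₁₂≡0)))
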